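{- Let $G$ be an $r$-regular Lehman graph with $k=1$ and $r\ge 3$, and let $\mathcal{P}$ be a partition of $V(G)$ into blocks each inducing a copy of $K_{r-1,r-1}$. Then $c(G,\mathcal{P})$ is $r$-regular.
   Context: A bipartite graph $G$ with $n$ black and $n$ white vertices has bipartite adjacency matrix $A$ (rows indexed by black vertices, columns by white vertices, entry $1$ iff adjacent). $G$ is an $r$-regular Lehman graph with $k=1$ if $G$ is $r$-regular and there is an $n\times n$ $(0,1)$-matrix $B$ with $AB^T=J+I$, $J$ the all-ones matrix and $I$ the identity. Given such a partition $\mathcal{P}$ (each block has $r-1$ black and $r-1$ white vertices), the compressed graph $c(G,\mathcal{P})$ is the simple bipartite graph with one black vertex $b_X$ and one white vertex $w_X$ for each block $X\in\mathcal{P}$, where $b_X$ is adjacent to $w_Y$ iff $X=Y$ or some black vertex of $X$ is adjacent in $G$ to some white vertex of $Y$. -}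

module Defs where

open import Data.Nat using (ℕ; zero; suc; _+_; _*_; _∸_; _≤_)
open import Data.Bool using (Bool; true; false; _∨_; _∧_; if_then_else_)
open import Data.Fin using (Fin; zero; suc; _≟_)
open import Data.Product using (Σ; _×_; ∃-syntax)
open import Relation.Nullary.Decidable using (⌊_⌋)
open import Relation.Binary.PropositionalEquality using (_≡_)

-- A bipartite graph with n black and n white vertices, given by its
-- bipartite adjacency matrix (rows: black vertices, columns: white vertices).
BipMatrix : ℕ → Set
BipMatrix n = Fin n → Fin n → Bool

⟦_⟧ : Bool → ℕ
⟦ b ⟧ = if b then 1 else 0

∑ : (n : ℕ) → (Fin n → ℕ) → ℕ
∑ zero    f = 0
∑ (suc n) f = f zero + ∑ n (λ i → f (suc i))

anyFin : (n : ℕ) → (Fin n → Bool) → Bool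
anyFin zero    f = false
anyFin (suc n) f = f zero ∨ anyFin n (λ i → f (suc i))

Regular : (n r : ℕ) → BipMatrix n → Set
Regular n r A =
  ((i : Fin n) → ∑ n (λ j → ⟦ A i j ⟧) ≡ r) ×
  ((j : Fin n) → ∑ n (λ i → ⟦ A i j ⟧) ≡ r)

JI : {n : ℕ} → Fin n → Fin n → ℕ
JI i j = if ⌊ i ≟ j ⌋ then 2 else 1

LehmanK1 : (n r : ℕ) → BipMatrix n → Set
LehmanK1 n r A =
  Regular n r A ×
  (Σ (BipMatrix n) λ B → ((i j : Fin n) → ∑ n (λ l → ⟦ A i l ⟧ * ⟦ B j l ⟧) ≡ JI i j))

record Partition (n m : ℕ) : Set where
  field
    blkB : Fin n → Fin m
    blkW : Fin n → Fin m
open Partition public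

blackCount : {n m : ℕ} → Partition n m → Fin m → ℕ
blackCount {n} P X = ∑ n (λ b → ⟦ ⌊ blkB P b ≟ X ⌋ ⟧)

whiteCount : {n m : ℕ} → Partition n m → Fin m → ℕ
whiteCount {n} P X = ∑ n (λ w → ⟦ ⌊ blkW P w ≟ X ⌋ ⟧)

BlocksInduceK : (n m r : ℕ) → BipMatrix n → Partition n m → Set
BlocksInduceK n m r A P =
  ((X : Fin m) → blackCount P X ≡ r ∸ 1) ×
  ((X : Fin m) → whiteCount P X ≡ r ∸ 1) ×
  ((b w : Fin n) → blkB P b ≡ blkW P w → A b w ≡ true)

compress : {n m : ℕ} → BipMatrix n → Partition n m → BipMatrix m
compress {n} A P X Y =
  ⌊ X ≟ Y ⌋ ∨
  anyFin n (λ b → anyFin n (λ w →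
    A b w ∧ ⌊ blkB P b ≟ X ⌋ ∧ ⌊ blkW P w ≟ Y ⌋))

-- Each black vertex b sees the r - 1 whites of its own block, so by r-regularity it has
-- exactly one neighbour exit b outside it, and the black vertex of block X in c(G, P) is
-- adjacent to X and to the blocks of exit b for the r - 1 blacks b of X.  These blocks differ
-- from X by construction, and from each other because of A Bᵀ = J + I and Bᵀ A = J + I.  The
-- latter holds because A Bᵀ = J + I makes A injective (any n + 1 vectors of ℤⁿ are linearly
-- dependent) and a regular A commutes with J.  Since both identities hold, the hypotheses are
-- symmetric under transposition, which exchanges the two colours and gives the white degrees.

module Submission where

open import Defs
open import Data.Nat using (ℕ; zero; suc; _≤_; z≤n; s≤s)
open import Data.Fin using (Fin; zero; suc; _≟_)
open import Data.Fin.Properties using (any?; suc-injective)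
open import Data.Bool using (Bool; true; false; T; _∨_; _∧_; not; if_then_else_)
open import Data.Product using (Σ; ∃-syntax; _×_; _,_; proj₁; proj₂)
open import Data.Empty using (⊥; ⊥-elim)
open import Data.Unit using (tt)
open import Function using (_∘_; id; Equivalence)
open import Relation.Nullary using (¬_; yes; no; ¬?; _×-dec_)
open import Relation.Nullary.Decidable
  using (⌊_⌋; ⌊⌋-map′; toWitness; fromWitness; toWitnessFalse; fromWitnessFalse; decidable-stable)
open import Relation.Nullary.Negation using (contradiction)
open import Relation.Binary.PropositionalEquality

module LinearAlgebra where

  import Data.Nat as ℕ
  open import Data.Integer using (ℤ; +_; 0ℤ; 1ℤ; -1ℤ; -_; _+_; _*_; _-_)
  import Data.Integer.Properties as ℤ
  open import Data.Integer.Tactic.RingSolver using (solve-∀)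
  open import Algebra.Properties.Semiring.Sum ℤ.+-*-semiring
    using (sum; sum-cong-≗; sum-replicate-zero; ∑-distrib-+; ∑-comm; *-distribˡ-sum; sum-remove)
  open import Algebra.Properties.AbelianGroup ℤ.+-0-abelianGroup using (inverseʳ-unique)
  open import Data.Fin using (punchIn)
  open import Data.Vec.Functional using (Vector; _∷_; insertAt)
  open import Data.Vec.Functional.Properties using (insertAt-lookup; insertAt-punchIn)
  open import Data.Sum using ([_,_]′)

  lincomb : ∀ {k d} → Vector ℤ k → (Fin k → Vector ℤ d) → Vector ℤ d
  lincomb c v x = sum λ j → c j * v j x

  Dependent : ∀ {k d} → (Fin k → Vector ℤ d) → Set
  Dependent {k} v =
    Σ (Vector ℤ k) λ c → (∃[ j ] c j ≢ 0ℤ) × (∀ x → lincomb c v x ≡ 0ℤ)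

  sum-zero : ∀ {n} (f : Vector ℤ n) → (∀ i → f i ≡ 0ℤ) → sum f ≡ 0ℤ
  sum-zero {n} f f≗0 = trans (sum-cong-≗ f≗0) (sum-replicate-zero n)

  extend-by-zero : ∀ {d} (v : Fin (suc (suc d)) → Vector ℤ (suc d)) →
    (∀ j → v j zero ≡ 0ℤ) → Dependent (λ j x → v (suc j) (suc x)) → Dependent v
  extend-by-zero v v₀≡0 (μ , (i , μi≢0) , μ-dep) = 0ℤ ∷ μ , (suc i , μi≢0) , dep
    where
    dep : ∀ x → lincomb (0ℤ ∷ μ) v x ≡ 0ℤ
    dep zero    = sum-zero (λ j → (0ℤ ∷ μ) j * v j zero) λ
      { zero    → ℤ.*-zeroˡ (v zero zero)
      ; (suc j) → trans (cong (μ j *_) (v₀≡0 (suc j))) (ℤ.*-zeroʳ (μ j)) }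
    dep (suc x) = trans (ℤ.+-identityˡ (lincomb μ (λ j → v (suc j)) (suc x))) (μ-dep x)

  eliminate : ∀ {d} (v : Fin (suc (suc d)) → Vector ℤ (suc d)) (k : Fin (suc (suc d))) →
    Fin (suc d) → Vector ℤ (suc d)
  eliminate v k i x = v k zero * v (punchIn k i) x - v (punchIn k i) zero * v k x

  back-substitute : ∀ {d} (v : Fin (suc (suc d)) → Vector ℤ (suc d)) (k : Fin (suc (suc d))) →
    v k zero ≢ 0ℤ → Dependent (λ i x → eliminate v k i (suc x)) → Dependent v
  back-substitute v k pivot≢0 (μ , (i₀ , μi₀≢0) , μ-dep) = c , (punchIn k i₀ , c-nonzero) , dep
    where
    p = v k zero
    q = λ i → v (punchIn k i)
    S = sum λ i → μ i * q i zero
    c = insertAt (λ i → μ i * p) k (- S)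
    P = λ x → sum λ i → μ i * p * q i x

    μ-kills : ∀ x → lincomb μ (eliminate v k) x ≡ 0ℤ
    μ-kills zero    = sum-zero (λ i → μ i * eliminate v k i zero) λ i → commutator (μ i) p (q i zero)
      where
      commutator : ∀ m a b → m * (a * b - b * a) ≡ 0ℤ
      commutator = solve-∀
    μ-kills (suc x) = μ-dep x

    balance : ∀ x → P x ≡ v k x * S
    balance x = ℤ.i-j≡0⇒i≡j (P x) (v k x * S) (begin
      P x - v k x * S
        ≡⟨ rearrange (P x) (v k x) S ⟩
      P x + (- v k x) * S
        ≡⟨ cong (λ z → P x + z) (*-distribˡ-sum (- v k x) (λ i → μ i * q i zero)) ⟩
      P x + sum (λ i → (- v k x) * (μ i * q i zero))
        ≡⟨ ∑-distrib-+ (λ i → μ i * p * q i x) (λ i → (- v k x) * (μ i * q i zero)) ⟨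
      sum (λ i → μ i * p * q i x + (- v k x) * (μ i * q i zero))
        ≡⟨ sum-cong-≗ (λ i → expand (μ i) p (q i x) (q i zero) (v k x)) ⟩
      lincomb μ (eliminate v k) x
        ≡⟨ μ-kills x ⟩
      0ℤ ∎)
      where
      open ≡-Reasoning
      rearrange : ∀ a b s → a - b * s ≡ a + (- b) * s
      rearrange = solve-∀
      expand : ∀ m a b e f → m * a * b + (- f) * (m * e) ≡ m * (a * b - e * f)
      expand = solve-∀

    dep : ∀ x → lincomb c v x ≡ 0ℤ
    dep x = begin
      lincomb c v x
        ≡⟨ sum-remove {i = k} (λ j → c j * v j x) ⟩
      c k * v k x + sum (λ i → c (punchIn k i) * q i x)
        ≡⟨ cong₂ (λ a b → a * v k x + b) (insertAt-lookup (λ i → μ i * p) k (- S))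
                 (sum-cong-≗ λ i → cong (_* q i x) (insertAt-punchIn (λ i → μ i * p) k (- S) i)) ⟩
      - S * v k x + P x
        ≡⟨ cong (λ z → - S * v k x + z) (balance x) ⟩
      - S * v k x + v k x * S
        ≡⟨ cancel S (v k x) ⟩
      0ℤ ∎
      where
      open ≡-Reasoning
      cancel : ∀ s a → - s * a + a * s ≡ 0ℤ
      cancel = solve-∀

    c-nonzero : c (punchIn k i₀) ≢ 0ℤ
    c-nonzero c≡0 = [ μi₀≢0 , pivot≢0 ]′
      (ℤ.i*j≡0⇒i≡0∨j≡0 (μ i₀) (trans (sym (insertAt-punchIn (λ i → μ i * p) k (- S) i₀)) c≡0))

  dependent : ∀ d (v : Fin (suc d) → Vector ℤ d) → Dependent v
  dependent zero    v = (λ _ → 1ℤ) , (zero , λ ()) , λ ()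
  dependent (suc d) v with any? (λ k → ¬? (v k zero ℤ.≟ 0ℤ))
  ... | yes (k , pivot≢0) = back-substitute v k pivot≢0 (dependent d (λ i x → eliminate v k i (suc x)))
  ... | no ¬pivot = extend-by-zero v no-pivot (dependent d (λ j x → v (suc j) (suc x)))
    where
    no-pivot : ∀ j → v j zero ≡ 0ℤ
    no-pivot j = decidable-stable (v j zero ℤ.≟ 0ℤ) (λ vj≢0 → ¬pivot (j , vj≢0))

  Matrix : ℕ → Set
  Matrix n = Fin n → Vector ℤ n

  infixl 7 _·_
  _·_ : ∀ {n} → Matrix n → Vector ℤ n → Vector ℤ n
  (a · u) i = sum λ l → a i l * u l

  ·-lincomb : ∀ {k n} (a : Matrix n) (c : Vector ℤ k) (v : Fin k → Vector ℤ n) i →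
    (a · lincomb c v) i ≡ lincomb c (λ j → a · v j) i
  ·-lincomb a c v i = begin
    sum (λ l → a i l * sum (λ j → c j * v j l))
      ≡⟨ sum-cong-≗ (λ l → *-distribˡ-sum (a i l) (λ j → c j * v j l)) ⟩
    sum (λ l → sum (λ j → a i l * (c j * v j l)))
      ≡⟨ sum-cong-≗ (λ l → sum-cong-≗ (λ j → swap (a i l) (c j) (v j l))) ⟩
    sum (λ l → sum (λ j → c j * (a i l * v j l)))
      ≡⟨ ∑-comm (λ l j → c j * (a i l * v j l)) ⟩
    sum (λ j → sum (λ l → c j * (a i l * v j l)))
      ≡⟨ sum-cong-≗ (λ j → *-distribˡ-sum (c j) (λ l → a i l * v j l)) ⟨
    sum (λ j → c j * sum (λ l → a i l * v j l)) ∎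
    where
    open ≡-Reasoning
    swap : ∀ x y z → x * (y * z) ≡ y * (x * z)
    swap = solve-∀

  ·-sub : ∀ {n} (a : Matrix n) (u v : Vector ℤ n) i →
    (a · (λ l → u l - v l)) i ≡ (a · u) i - (a · v) i
  ·-sub a u v i = begin
    sum (λ l → a i l * (u l - v l))
      ≡⟨ sum-cong-≗ (λ l → split (a i l) (u l) (v l)) ⟩
    sum (λ l → a i l * u l + -1ℤ * (a i l * v l))
      ≡⟨ ∑-distrib-+ (λ l → a i l * u l) (λ l → -1ℤ * (a i l * v l)) ⟩
    (a · u) i + sum (λ l → -1ℤ * (a i l * v l))
      ≡⟨ cong (λ z → (a · u) i + z) (*-distribˡ-sum -1ℤ (λ l → a i l * v l)) ⟨
    (a · u) i + -1ℤ * (a · v) i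
      ≡⟨ merge ((a · u) i) ((a · v) i) ⟩
    (a · u) i - (a · v) i ∎
    where
    open ≡-Reasoning
    split : ∀ x y z → x * (y - z) ≡ x * y + -1ℤ * (x * z)
    split = solve-∀
    merge : ∀ x y → x + -1ℤ * y ≡ x - y
    merge = solve-∀

  JI-suc : ∀ {n} (i j : Fin n) → JI (suc i) (suc j) ≡ JI i j
  JI-suc i j = cong (λ b → if b then 2 else 1) (⌊⌋-map′ (cong suc) suc-injective (i ≟ j))

  sum-*JI : ∀ {n} (c : Vector ℤ n) i → sum (λ j → c j * + JI i j) ≡ sum c + c i
  sum-*JI {suc n} c zero = begin
    c zero * + 2 + sum (λ j → c (suc j) * 1ℤ)
      ≡⟨ cong (λ z → c zero * + 2 + z) (sum-cong-≗ (λ j → ℤ.*-identityʳ (c (suc j)))) ⟩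
    c zero * + 2 + sum (λ j → c (suc j))
      ≡⟨ double (c zero) (sum λ j → c (suc j)) ⟩
    c zero + sum (λ j → c (suc j)) + c zero ∎
    where
    open ≡-Reasoning
    double : ∀ x s → x * + 2 + s ≡ x + s + x
    double = solve-∀
  sum-*JI {suc n} c (suc i) = begin
    c zero * 1ℤ + sum (λ j → c (suc j) * + JI (suc i) (suc j))
      ≡⟨ cong (λ z → c zero * 1ℤ + z) (sum-cong-≗ (λ j → cong (λ e → c (suc j) * + e) (JI-suc i j))) ⟩
    c zero * 1ℤ + sum (λ j → c (suc j) * + JI i j)
      ≡⟨ cong (λ z → c zero * 1ℤ + z) (sum-*JI (λ j → c (suc j)) i) ⟩
    c zero * 1ℤ + (sum (λ j → c (suc j)) + c (suc i))
      ≡⟨ reassociate (c zero) (sum λ j → c (suc j)) (c (suc i)) ⟩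
    c zero + sum (λ j → c (suc j)) + c (suc i) ∎
    where
    open ≡-Reasoning
    reassociate : ∀ x s y → x * 1ℤ + (s + y) ≡ x + s + y
    reassociate = solve-∀

  sum-const : ∀ n x → sum {n} (λ _ → x) ≡ + n * x
  sum-const zero    x = sym (ℤ.*-zeroˡ x)
  sum-const (suc n) x = trans (cong (λ z → x + z) (sum-const n x)) (sym (ℤ.suc-* (+ n) x))

  sum+entry≡0⇒entry≡0 : ∀ {n} (c : Vector ℤ n) → (∀ i → sum c + c i ≡ 0ℤ) → ∀ i → c i ≡ 0ℤ
  sum+entry≡0⇒entry≡0 {n} c total+entry≡0 i = begin
    c i   ≡⟨ entry≡-total i ⟩
    - S   ≡⟨ cong -_ S≡0 ⟩
    0ℤ    ∎
    where
    open ≡-Reasoning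
    S = sum c
    entry≡-total : ∀ i → c i ≡ - S
    entry≡-total i = inverseʳ-unique S (c i) (total+entry≡0 i)
    S≡n*-S : S ≡ + n * - S
    S≡n*-S = trans (sum-cong-≗ entry≡-total) (sum-const n (- S))
    cancel : ∀ m s → m * - s + m * s ≡ 0ℤ
    cancel = solve-∀
    suc-n*S≡0 : + suc n * S ≡ 0ℤ
    suc-n*S≡0 = begin
      + suc n * S         ≡⟨ ℤ.suc-* (+ n) S ⟩
      S + + n * S         ≡⟨ cong (λ z → z + + n * S) S≡n*-S ⟩
      + n * - S + + n * S ≡⟨ cancel (+ n) S ⟩
      0ℤ                  ∎
    S≡0 : S ≡ 0ℤ
    S≡0 = [ (λ ()) , id ]′ (ℤ.i*j≡0⇒i≡0∨j≡0 (+ suc n) suc-n*S≡0)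

  -- Apply a to a linear relation between d and the rows of b: by A Bᵀ = J + I the coefficients
  -- c of the rows satisfy sum c + c i = 0, so they vanish and the relation is a multiple of d.
  kernel-trivial : ∀ {n} (a b : Matrix n) → (∀ j i → (a · b j) i ≡ + JI i j) →
    ∀ d → (∀ i → (a · d) i ≡ 0ℤ) → ∀ l → d l ≡ 0ℤ
  kernel-trivial {n} a b abᵀ≡JI d ad≡0 = d≡0
    where
    dependence = dependent n (d ∷ b)
    c = proj₁ dependence
    cb = λ j → c (suc j)

    ·-dependence : ∀ i → sum cb + cb i ≡ 0ℤ
    ·-dependence i = begin
      sum cb + cb i
        ≡⟨ sum-*JI cb i ⟨
      sum (λ j → cb j * + JI i j)
        ≡⟨ sum-cong-≗ (λ j → cong (cb j *_) (abᵀ≡JI j i)) ⟨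
      sum (λ j → cb j * (a · b j) i)
        ≡⟨ ℤ.+-identityˡ _ ⟨
      0ℤ + sum (λ j → cb j * (a · b j) i)
        ≡⟨ cong (λ z → z + sum (λ j → cb j * (a · b j) i))
                (trans (cong (c zero *_) (ad≡0 i)) (ℤ.*-zeroʳ (c zero))) ⟨
      lincomb c (λ j → a · (d ∷ b) j) i
        ≡⟨ ·-lincomb a c (d ∷ b) i ⟨
      (a · lincomb c (d ∷ b)) i
        ≡⟨ sum-zero (λ l → a i l * lincomb c (d ∷ b) l)
                    (λ l → trans (cong (a i l *_) (proj₂ (proj₂ dependence) l)) (ℤ.*-zeroʳ (a i l))) ⟩
      0ℤ ∎
      where open ≡-Reasoning

    cb≡0 : ∀ j → cb j ≡ 0ℤ
    cb≡0 = sum+entry≡0⇒entry≡0 cb ·-dependence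

    c₀≢0 : c zero ≢ 0ℤ
    c₀≢0 with proj₁ (proj₂ dependence)
    ... | zero  , c₀≢0 = c₀≢0
    ... | suc j , cj≢0 = contradiction (cb≡0 j) cj≢0

    d≡0 : ∀ l → d l ≡ 0ℤ
    d≡0 l = [ (λ c₀≡0 → contradiction c₀≡0 c₀≢0) , id ]′ (ℤ.i*j≡0⇒i≡0∨j≡0 (c zero) (begin
      c zero * d l
        ≡⟨ ℤ.+-identityʳ _ ⟨
      c zero * d l + 0ℤ
        ≡⟨ cong (λ z → c zero * d l + z)
                (sum-zero (λ j → cb j * b j l) (λ j → trans (cong (_* b j l) (cb≡0 j)) (ℤ.*-zeroˡ (b j l)))) ⟨
      lincomb c (d ∷ b) l
        ≡⟨ proj₂ (proj₂ dependence) l ⟩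
      0ℤ ∎))
      where open ≡-Reasoning

  ·-injective : ∀ {n} (a b : Matrix n) → (∀ j i → (a · b j) i ≡ + JI i j) →
    ∀ u v → (∀ i → (a · u) i ≡ (a · v) i) → ∀ l → u l ≡ v l
  ·-injective a b abᵀ≡JI u v au≡av l = ℤ.i-j≡0⇒i≡j (u l) (v l)
    (kernel-trivial a b abᵀ≡JI (λ l → u l - v l)
      (λ i → trans (·-sub a u v i) (trans (cong (λ z → z - (a · v) i) (au≡av i)) (ℤ.+-inverseʳ ((a · v) i)))) l)

  -- A (Bᵀ A) = (J + I) A and A (J + I) both equal r J + A, and A is injective.
  transpose-factor : ∀ {n r} (a b : Matrix n) →
    (∀ i → sum (a i) ≡ + r) → (∀ l → sum (λ i → a i l) ≡ + r) →
    (∀ j i → (a · b j) i ≡ + JI i j) →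
    ∀ w′ w → lincomb (λ j → a j w′) b w ≡ + JI w′ w
  transpose-factor a b rows cols abᵀ≡JI w′ =
    ·-injective a b abᵀ≡JI (lincomb (λ j → a j w′) b) (λ w → + JI w′ w) same-image
    where
    open ≡-Reasoning
    same-image : ∀ i → (a · lincomb (λ j → a j w′) b) i ≡ (a · (λ w → + JI w′ w)) i
    same-image i = begin
      (a · lincomb (λ j → a j w′) b) i       ≡⟨ ·-lincomb a (λ j → a j w′) b i ⟩
      sum (λ j → a j w′ * (a · b j) i)        ≡⟨ sum-cong-≗ (λ j → cong (a j w′ *_) (abᵀ≡JI j i)) ⟩
      sum (λ j → a j w′ * + JI i j)           ≡⟨ sum-*JI (λ j → a j w′) i ⟩
      sum (λ j → a j w′) + a i w′             ≡⟨ cong (_+ a i w′) (trans (cols w′) (sym (rows i))) ⟩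
      sum (a i) + a i w′                      ≡⟨ sum-*JI (a i) w′ ⟨
      sum (λ w → a i w * + JI w′ w)           ∎

  ∑-as-sum : ∀ n (f : Fin n → ℕ) → + ∑ n f ≡ sum (λ i → + f i)
  ∑-as-sum zero    f = refl
  ∑-as-sum (suc n) f =
    trans (ℤ.pos-+ (f zero) (∑ n (f ∘ suc))) (cong (λ z → + f zero + z) (∑-as-sum n (f ∘ suc)))

  ∑-products-as-sum : ∀ n (f g : Fin n → ℕ) → + ∑ n (λ l → f l ℕ.* g l) ≡ sum (λ l → + f l * + g l)
  ∑-products-as-sum n f g = trans (∑-as-sum n (λ l → f l ℕ.* g l)) (sum-cong-≗ (λ l → ℤ.pos-* (f l) (g l)))

  transpose-⟦⟧-factor : ∀ {n r} (A B : BipMatrix n) → Regular n r A →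
    (∀ i j → ∑ n (λ l → ⟦ A i l ⟧ ℕ.* ⟦ B j l ⟧) ≡ JI i j) →
    ∀ i j → ∑ n (λ l → ⟦ A l i ⟧ ℕ.* ⟦ B l j ⟧) ≡ JI i j
  transpose-⟦⟧-factor {n} {r} A B (rows , cols) AB i j = ℤ.+-injective (begin
    + ∑ n (λ l → ⟦ A l i ⟧ ℕ.* ⟦ B l j ⟧) ≡⟨ ∑-products-as-sum n (λ l → ⟦ A l i ⟧) (λ l → ⟦ B l j ⟧) ⟩
    lincomb (λ l → a l i) b j             ≡⟨ transpose-factor a b rowsℤ colsℤ abᵀ≡JI i j ⟩
    + JI i j                              ∎)
    where
    open ≡-Reasoning
    a b : Matrix n
    a i l = + ⟦ A i l ⟧
    b j l = + ⟦ B j l ⟧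
    rowsℤ : ∀ i → sum (a i) ≡ + r
    rowsℤ i = trans (sym (∑-as-sum n (λ l → ⟦ A i l ⟧))) (cong +_ (rows i))
    colsℤ : ∀ l → sum (λ i → a i l) ≡ + r
    colsℤ l = trans (sym (∑-as-sum n (λ i → ⟦ A i l ⟧))) (cong +_ (cols l))
    abᵀ≡JI : ∀ j i → (a · b j) i ≡ + JI i j
    abᵀ≡JI j i =
      trans (sym (∑-products-as-sum n (λ l → ⟦ A i l ⟧) (λ l → ⟦ B j l ⟧))) (cong +_ (AB i j))

open LinearAlgebra using (transpose-⟦⟧-factor)
open import Data.Nat using (_+_; _*_)
import Data.Nat.Properties as ℕ
open import Algebra.Properties.CommutativeSemigroup ℕ.+-commutativeSemigroup
  using () renaming (interchange to +-interchange)
open import Data.Bool.Properties using (T-≡; T-∨; T-∧; ∧-identityʳ)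
open import Data.Sum using (inj₁; inj₂)

⟦⟧-true : ∀ {x} → T x → ⟦ x ⟧ ≡ 1
⟦⟧-true {true} _ = refl

⟦⟧-false : ∀ {x} → ¬ T x → ⟦ x ⟧ ≡ 0
⟦⟧-false {true}  ¬x = contradiction tt ¬x
⟦⟧-false {false} _  = refl

⟦⟧-≤1 : ∀ x → ⟦ x ⟧ ≤ 1
⟦⟧-≤1 true  = s≤s z≤n
⟦⟧-≤1 false = z≤n

⟦⟧-nonzero : ∀ {x} → ⟦ x ⟧ ≢ 0 → T x
⟦⟧-nonzero {true}  _  = tt
⟦⟧-nonzero {false} x≢0 = contradiction refl x≢0

⟦⟧-injective : ∀ {x y} → ⟦ x ⟧ ≡ ⟦ y ⟧ → x ≡ y
⟦⟧-injective {true}  {true}  _ = refl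
⟦⟧-injective {false} {false} _ = refl

⟦⟧-*-true : ∀ {x y} → T x → T y → ⟦ x ⟧ * ⟦ y ⟧ ≡ 1
⟦⟧-*-true {true} {true} _ _ = refl

⟦⟧-*-nonzero : ∀ x y → ⟦ x ⟧ * ⟦ y ⟧ ≢ 0 → T x × T y
⟦⟧-*-nonzero true  true  _ = tt , tt
⟦⟧-*-nonzero true  false p = contradiction refl p
⟦⟧-*-nonzero false _     p = contradiction refl p

⟦⟧-∨ : ∀ x y → ¬ (T x × T y) → ⟦ x ∨ y ⟧ ≡ ⟦ x ⟧ + ⟦ y ⟧
⟦⟧-∨ true  true  ¬both = contradiction (tt , tt) ¬both
⟦⟧-∨ true  false _     = refl
⟦⟧-∨ false _     _     = refl

T-ext : ∀ {x y} → (T x → T y) → (T y → T x) → x ≡ y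
T-ext {true}  {true}  _ _ = refl
T-ext {true}  {false} f _ = ⊥-elim (f tt)
T-ext {false} {true}  _ g = ⊥-elim (g tt)
T-ext {false} {false} _ _ = refl

anyFin-witness : ∀ n (f : Fin n → Bool) → T (anyFin n f) → ∃[ i ] T (f i)
anyFin-witness (suc n) f any with Equivalence.to T-∨ any
... | inj₁ f₀ = zero , f₀
... | inj₂ rest with anyFin-witness n (f ∘ suc) rest
...   | i , fi = suc i , fi

anyFin-intro : ∀ n (f : Fin n → Bool) i → T (f i) → T (anyFin n f)
anyFin-intro (suc n) f zero    fi = Equivalence.from T-∨ (inj₁ fi)
anyFin-intro (suc n) f (suc i) fi = Equivalence.from T-∨ (inj₂ (anyFin-intro n (f ∘ suc) i fi))

∑-cong : ∀ n {f g : Fin n → ℕ} → (∀ i → f i ≡ g i) → ∑ n f ≡ ∑ n g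
∑-cong zero    f≗g = refl
∑-cong (suc n) f≗g = cong₂ _+_ (f≗g zero) (∑-cong n (f≗g ∘ suc))

∑-+ : ∀ n (f g : Fin n → ℕ) → ∑ n (λ i → f i + g i) ≡ ∑ n f + ∑ n g
∑-+ zero    f g = refl
∑-+ (suc n) f g = trans (cong (f zero + g zero +_) (∑-+ n (f ∘ suc) (g ∘ suc)))
                        (+-interchange (f zero) (g zero) (∑ n (f ∘ suc)) (∑ n (g ∘ suc)))

∑-zero : ∀ n {f : Fin n → ℕ} → (∀ i → f i ≡ 0) → ∑ n f ≡ 0
∑-zero n f≗0 = trans (∑-cong n f≗0) (∑-0 n)
  where
  ∑-0 : ∀ n → ∑ n (λ _ → 0) ≡ 0
  ∑-0 zero    = refl
  ∑-0 (suc n) = ∑-0 n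

∑-only : ∀ n (f : Fin n → ℕ) i → (∀ j → j ≢ i → f j ≡ 0) → ∑ n f ≡ f i
∑-only (suc n) f zero    others =
  trans (cong (f zero +_) (∑-zero n (λ j → others (suc j) λ ()))) (ℕ.+-identityʳ (f zero))
∑-only (suc n) f (suc i) others =
  cong₂ _+_ (others zero λ ()) (∑-only n (f ∘ suc) i (λ j j≢i → others (suc j) (j≢i ∘ suc-injective)))

∑-other : ∀ n (f : Fin n → ℕ) i → ∑ n f ≢ f i → ∃[ j ] j ≢ i × f j ≢ 0
∑-other n f i ∑≢fi with any? (λ j → ¬? (j ≟ i) ×-dec ¬? (f j ℕ.≟ 0))
... | yes other = other
... | no ¬other = contradiction
  (∑-only n f i (λ j j≢i → decidable-stable (f j ℕ.≟ 0) (λ fj≢0 → ¬other (j , j≢i , fj≢0)))) ∑≢fi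

∑-term-≤ : ∀ n (f : Fin n → ℕ) i → f i ≤ ∑ n f
∑-term-≤ (suc n) f zero    = ℕ.m≤m+n (f zero) (∑ n (f ∘ suc))
∑-term-≤ (suc n) f (suc i) = ℕ.≤-trans (∑-term-≤ n (f ∘ suc) i) (ℕ.m≤n+m (∑ n (f ∘ suc)) (f zero))

∑-pair-≤ : ∀ n (f : Fin n → ℕ) {i j} → i ≢ j → f i + f j ≤ ∑ n f
∑-pair-≤ (suc n) f {zero}  {zero}  i≢j = contradiction refl i≢j
∑-pair-≤ (suc n) f {zero}  {suc j} _   = ℕ.+-monoʳ-≤ (f zero) (∑-term-≤ n (f ∘ suc) j)
∑-pair-≤ (suc n) f {suc i} {zero}  _   =
  subst (_≤ ∑ (suc n) f) (ℕ.+-comm (f zero) (f (suc i))) (ℕ.+-monoʳ-≤ (f zero) (∑-term-≤ n (f ∘ suc) i))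
∑-pair-≤ (suc n) f {suc i} {suc j} i≢j =
  ℕ.≤-trans (∑-pair-≤ n (f ∘ suc) (i≢j ∘ cong suc)) (ℕ.m≤n+m (∑ n (f ∘ suc)) (f zero))

∑⟦⟧≡0 : ∀ n (f : Fin n → Bool) → ∑ n (λ i → ⟦ f i ⟧) ≡ 0 → ∀ i → f i ≡ false
∑⟦⟧≡0 (suc n) f ∑≡0 zero    = ⟦⟧-injective (ℕ.m+n≡0⇒m≡0 ⟦ f zero ⟧ ∑≡0)
∑⟦⟧≡0 (suc n) f ∑≡0 (suc i) = ∑⟦⟧≡0 n (f ∘ suc) (ℕ.m+n≡0⇒n≡0 ⟦ f zero ⟧ ∑≡0) i

∑⟦⟧≡1 : ∀ n (f : Fin n → Bool) → ∑ n (λ i → ⟦ f i ⟧) ≡ 1 → ∃[ l ] ∀ i → f i ≡ ⌊ i ≟ l ⌋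
∑⟦⟧≡1 (suc n) f ∑≡1 with f zero in f₀
... | true  = zero , λ
  { zero    → f₀
  ; (suc i) → ∑⟦⟧≡0 n (f ∘ suc) (ℕ.suc-injective ∑≡1) i }
... | false with ∑⟦⟧≡1 n (f ∘ suc) ∑≡1
...   | l , f≗l = suc l , λ
  { zero    → f₀
  ; (suc i) → trans (f≗l i) (sym (⌊⌋-map′ (cong suc) suc-injective (i ≟ l))) }

⟦≟⟧-refl : ∀ {m} (y : Fin m) → ⟦ ⌊ y ≟ y ⌋ ⟧ ≡ 1
⟦≟⟧-refl y = ⟦⟧-true {⌊ y ≟ y ⌋} (fromWitness refl)

⟦≟⟧-distinct : ∀ {m} {y Y : Fin m} → y ≢ Y → ⟦ ⌊ y ≟ Y ⌋ ⟧ ≡ 0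
⟦≟⟧-distinct {y = y} {Y} y≢Y = ⟦⟧-false {⌊ y ≟ Y ⌋} (y≢Y ∘ toWitness)

∑-dirac : ∀ m (y : Fin m) → ∑ m (λ Y → ⟦ ⌊ y ≟ Y ⌋ ⟧) ≡ 1
∑-dirac m y =
  trans (∑-only m (λ Y → ⟦ ⌊ y ≟ Y ⌋ ⟧) y (λ Y Y≢y → ⟦≟⟧-distinct (Y≢y ∘ sym))) (⟦≟⟧-refl y)

∑-pick : ∀ n (w : Fin n) (f : Fin n → ℕ) → ∑ n (λ l → ⟦ ⌊ l ≟ w ⌋ ⟧ * f l) ≡ f w
∑-pick n w f =
  trans (∑-only n (λ l → ⟦ ⌊ l ≟ w ⌋ ⟧ * f l) w (λ l l≢w → cong (_* f l) (⟦≟⟧-distinct l≢w)))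
        (trans (cong (_* f w) (⟦≟⟧-refl w)) (ℕ.*-identityˡ (f w)))

∑-image : ∀ n m (p : Fin n → Bool) (g : Fin n → Fin m) →
  (∀ a b → T (p a) → T (p b) → g a ≡ g b → a ≡ b) →
  ∑ m (λ Y → ⟦ anyFin n (λ b → p b ∧ ⌊ g b ≟ Y ⌋) ⟧) ≡ ∑ n (λ b → ⟦ p b ⟧)
∑-image zero    m p g inj = ∑-zero m (λ _ → refl)
∑-image (suc n) m p g inj = begin
  ∑ m (λ Y → ⟦ hit zero Y ∨ anyFin n (λ b → hit (suc b) Y) ⟧)
    ≡⟨ ∑-cong m (λ Y → ⟦⟧-∨ (hit zero Y) _ (disjoint Y)) ⟩
  ∑ m (λ Y → ⟦ hit zero Y ⟧ + ⟦ anyFin n (λ b → hit (suc b) Y) ⟧)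
    ≡⟨ ∑-+ m (λ Y → ⟦ hit zero Y ⟧) (λ Y → ⟦ anyFin n (λ b → hit (suc b) Y) ⟧) ⟩
  ∑ m (λ Y → ⟦ hit zero Y ⟧) + ∑ m (λ Y → ⟦ anyFin n (λ b → hit (suc b) Y) ⟧)
    ≡⟨ cong₂ _+_ first (∑-image n m (p ∘ suc) (g ∘ suc)
                          (λ a b pa pb ga≡gb → suc-injective (inj (suc a) (suc b) pa pb ga≡gb))) ⟩
  ⟦ p zero ⟧ + ∑ n (λ b → ⟦ p (suc b) ⟧) ∎
  where
  open ≡-Reasoning
  hit : Fin (suc n) → Fin m → Bool
  hit b Y = p b ∧ ⌊ g b ≟ Y ⌋
  disjoint : ∀ Y → ¬ (T (hit zero Y) × T (anyFin n (λ b → hit (suc b) Y)))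
  disjoint Y (hit₀ , hitₛ) with anyFin-witness n (λ b → hit (suc b) Y) hitₛ
  ... | b , hitb with Equivalence.to T-∧ hit₀ | Equivalence.to T-∧ hitb
  ...   | p₀ , g₀≡Y | pb , gb≡Y with inj zero (suc b) p₀ pb (trans (toWitness g₀≡Y) (sym (toWitness gb≡Y)))
  ...     | ()
  first : ∑ m (λ Y → ⟦ hit zero Y ⟧) ≡ ⟦ p zero ⟧
  first with p zero
  ... | true  = ∑-dirac m (g zero)
  ... | false = ∑-zero m (λ _ → refl)

infix 10 _ᵀ
_ᵀ : ∀ {n} → BipMatrix n → BipMatrix n
(A ᵀ) i j = A j i

JIFactor : ∀ {n} → BipMatrix n → BipMatrix n → Set
JIFactor {n} A B = ∀ i j → ∑ n (λ l → ⟦ A i l ⟧ * ⟦ B j l ⟧) ≡ JI i j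

JI≡suc : ∀ {n} (i j : Fin n) → JI i j ≡ suc ⟦ ⌊ i ≟ j ⌋ ⟧
JI≡suc i j with ⌊ i ≟ j ⌋
... | true  = refl
... | false = refl

JI-diag : ∀ {n} (i : Fin n) → JI i i ≡ 2
JI-diag i = trans (JI≡suc i i) (cong suc (⟦≟⟧-refl i))

JI-offdiag : ∀ {n} {i j : Fin n} → i ≢ j → JI i j ≡ 1
JI-offdiag {i = i} {j} i≢j = trans (JI≡suc i j) (cong suc (⟦≟⟧-distinct i≢j))

module _ {n} (A B : BipMatrix n) (AB : JIFactor A B) where

  JIFactor-rows-injective : ∀ {b b′} → (∀ l → A b l ≡ A b′ l) → b ≡ b′
  JIFactor-rows-injective {b} {b′} same-row with b ≟ b′
  ... | yes b≡b′ = b≡b′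
  ... | no  b≢b′ = contradiction (begin
    2                                        ≡⟨ JI-diag b ⟨
    JI b b                                   ≡⟨ AB b b ⟨
    ∑ n (λ l → ⟦ A b l ⟧ * ⟦ B b l ⟧)        ≡⟨ ∑-cong n (λ l → cong (λ x → ⟦ x ⟧ * ⟦ B b l ⟧) (same-row l)) ⟩
    ∑ n (λ l → ⟦ A b′ l ⟧ * ⟦ B b l ⟧)       ≡⟨ AB b′ b ⟩
    JI b′ b                                  ≡⟨ JI-offdiag (b≢b′ ∘ sym) ⟩
    1                                        ∎) λ ()
    where open ≡-Reasoning

  JIFactor-no-common-pair : ∀ {i j l l′} → i ≢ j → l ≢ l′ →
    T (A i l) → T (A i l′) → T (B j l) → T (B j l′) → ⊥
  JIFactor-no-common-pair {i} {j} {l} {l′} i≢j l≢l′ Ail Ail′ Bjl Bjl′ = ℕ.1+n≰n (begin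
    2                                                ≡⟨ cong₂ _+_ (⟦⟧-*-true Ail Bjl) (⟦⟧-*-true Ail′ Bjl′) ⟨
    ⟦ A i l ⟧ * ⟦ B j l ⟧ + ⟦ A i l′ ⟧ * ⟦ B j l′ ⟧  ≤⟨ ∑-pair-≤ n (λ k → ⟦ A i k ⟧ * ⟦ B j k ⟧) l≢l′ ⟩
    ∑ n (λ k → ⟦ A i k ⟧ * ⟦ B j k ⟧)                ≡⟨ AB i j ⟩
    JI i j                                           ≡⟨ JI-offdiag i≢j ⟩
    1                                                ∎)
    where open ℕ.≤-Reasoning

module BlackDegree {n m s : ℕ} (A B : BipMatrix n) (P : Partition n m)
  (2≤s : 2 ≤ s)
  (degree : ∀ b → ∑ n (λ w → ⟦ A b w ⟧) ≡ suc s)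
  (blacks : ∀ X → blackCount P X ≡ s)
  (whites : ∀ X → whiteCount P X ≡ s)
  (complete : ∀ b w → blkB P b ≡ blkW P w → A b w ≡ true)
  (AB : JIFactor A B) (AᵀBᵀ : JIFactor (A ᵀ) (B ᵀ)) where

  inBlock : Fin n → Fin n → Bool
  inBlock b w = ⌊ blkW P w ≟ blkB P b ⌋

  leaves : Fin n → Fin n → Bool
  leaves b w = A b w ∧ not (inBlock b w)

  A-split : ∀ b w → ⟦ A b w ⟧ ≡ ⟦ inBlock b w ⟧ + ⟦ leaves b w ⟧
  A-split b w with blkW P w ≟ blkB P b
  ... | yes same rewrite complete b w (sym same) = refl
  ... | no  _    = cong ⟦_⟧ (sym (∧-identityʳ (A b w)))

  one-exit : ∀ b → ∑ n (λ w → ⟦ leaves b w ⟧) ≡ 1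
  one-exit b = ℕ.+-cancelˡ-≡ s _ _ (begin
    s + ∑ n (λ w → ⟦ leaves b w ⟧)
      ≡⟨ cong (_+ ∑ n (λ w → ⟦ leaves b w ⟧)) (whites (blkB P b)) ⟨
    ∑ n (λ w → ⟦ inBlock b w ⟧) + ∑ n (λ w → ⟦ leaves b w ⟧)
      ≡⟨ ∑-+ n (λ w → ⟦ inBlock b w ⟧) (λ w → ⟦ leaves b w ⟧) ⟨
    ∑ n (λ w → ⟦ inBlock b w ⟧ + ⟦ leaves b w ⟧)
      ≡⟨ ∑-cong n (A-split b) ⟨
    ∑ n (λ w → ⟦ A b w ⟧)
      ≡⟨ degree b ⟩
    suc s
      ≡⟨ ℕ.+-comm 1 s ⟩
    s + 1 ∎)
    where open ≡-Reasoning

  opaque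
    exit : Fin n → Fin n
    exit b = proj₁ (∑⟦⟧≡1 n (leaves b) (one-exit b))

    leaves≡exit : ∀ b w → leaves b w ≡ ⌊ w ≟ exit b ⌋
    leaves≡exit b = proj₂ (∑⟦⟧≡1 n (leaves b) (one-exit b))

  exit-leaves : ∀ b → T (A b (exit b)) × blkW P (exit b) ≢ blkB P b
  exit-leaves b with Equivalence.to T-∧ (subst T (sym (leaves≡exit b (exit b))) (fromWitness refl))
  ... | A-exit , outside = A-exit , toWitnessFalse outside

  exit-unique : ∀ b w → T (A b w) → blkW P w ≢ blkB P b → w ≡ exit b
  exit-unique b w Abw outside =
    toWitness (subst T (leaves≡exit b w) (Equivalence.from T-∧ (Abw , fromWitnessFalse outside)))

  A-row : ∀ b w → ⟦ A b w ⟧ ≡ ⟦ inBlock b w ⟧ + ⟦ ⌊ w ≟ exit b ⌋ ⟧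
  A-row b w = trans (A-split b w) (cong (λ x → ⟦ inBlock b w ⟧ + ⟦ x ⟧) (leaves≡exit b w))

  determined-by-block-and-exit : ∀ {b b′} → blkB P b ≡ blkB P b′ → exit b ≡ exit b′ → b ≡ b′
  determined-by-block-and-exit {b} {b′} same-block same-exit = JIFactor-rows-injective A B AB λ w →
    ⟦⟧-injective (trans (A-row b w) (trans
      (cong₂ (λ X e → ⟦ ⌊ blkW P w ≟ X ⌋ ⟧ + ⟦ ⌊ w ≟ e ⌋ ⟧) same-block same-exit) (sym (A-row b′ w))))

  another-in-block : ∀ X j → ∃[ c ] blkB P c ≡ X × c ≢ j
  another-in-block X j with ∑-other n (λ c → ⟦ ⌊ blkB P c ≟ X ⌋ ⟧) j too-many
    where
    too-many : blackCount P X ≢ ⟦ ⌊ blkB P j ≟ X ⌋ ⟧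
    too-many count≡ = ℕ.1+n≰n (ℕ.≤-trans 2≤s (subst (_≤ 1) (trans (sym count≡) (blacks X)) (⟦⟧-≤1 _)))
  ... | c , c≢j , counted = c , toWitness (⟦⟧-nonzero counted) , c≢j

  B-in-block : Fin m → Fin n → ℕ
  B-in-block X j = ∑ n (λ w → ⟦ ⌊ blkW P w ≟ X ⌋ ⟧ * ⟦ B j w ⟧)

  JI-split : ∀ b j → JI b j ≡ B-in-block (blkB P b) j + ⟦ B j (exit b) ⟧
  JI-split b j = begin
    JI b j
      ≡⟨ AB b j ⟨
    ∑ n (λ w → ⟦ A b w ⟧ * ⟦ B j w ⟧)
      ≡⟨ ∑-cong n (λ w → trans (cong (_* ⟦ B j w ⟧) (A-row b w))
                                (ℕ.*-distribʳ-+ ⟦ B j w ⟧ ⟦ inBlock b w ⟧ ⟦ ⌊ w ≟ exit b ⌋ ⟧)) ⟩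
    ∑ n (λ w → ⟦ inBlock b w ⟧ * ⟦ B j w ⟧ + ⟦ ⌊ w ≟ exit b ⌋ ⟧ * ⟦ B j w ⟧)
      ≡⟨ ∑-+ n (λ w → ⟦ inBlock b w ⟧ * ⟦ B j w ⟧) (λ w → ⟦ ⌊ w ≟ exit b ⌋ ⟧ * ⟦ B j w ⟧) ⟩
    B-in-block (blkB P b) j + ∑ n (λ w → ⟦ ⌊ w ≟ exit b ⌋ ⟧ * ⟦ B j w ⟧)
      ≡⟨ cong (B-in-block (blkB P b) j +_) (∑-pick n (exit b) (λ w → ⟦ B j w ⟧)) ⟩
    B-in-block (blkB P b) j + ⟦ B j (exit b) ⟧ ∎
    where open ≡-Reasoning

  B-exit : ∀ b → T (B b (exit b))
  B-exit b with another-in-block (blkB P b) b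
  ... | b′ , same-block , b′≢b = ⟦⟧-nonzero (λ x≡0 → ℕ.0≢1+n (trans (sym x≡0) one-more))
    where
    open ≡-Reasoning
    one-more : ⟦ B b (exit b) ⟧ ≡ suc ⟦ B b (exit b′) ⟧
    one-more = ℕ.+-cancelˡ-≡ (B-in-block (blkB P b) b) _ _ (begin
      B-in-block (blkB P b) b + ⟦ B b (exit b) ⟧
        ≡⟨ JI-split b b ⟨
      JI b b
        ≡⟨ trans (JI-diag b) (cong suc (sym (JI-offdiag b′≢b))) ⟩
      suc (JI b′ b)
        ≡⟨ cong suc (JI-split b′ b) ⟩
      suc (B-in-block (blkB P b′) b + ⟦ B b (exit b′) ⟧)
        ≡⟨ cong (λ X → suc (B-in-block X b + ⟦ B b (exit b′) ⟧)) same-block ⟩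
      suc (B-in-block (blkB P b) b + ⟦ B b (exit b′) ⟧)
        ≡⟨ ℕ.+-suc (B-in-block (blkB P b) b) _ ⟨
      B-in-block (blkB P b) b + suc ⟦ B b (exit b′) ⟧ ∎)

  B-exit-shared : ∀ {b b′ j} → blkB P b ≡ blkB P b′ → j ≢ b → j ≢ b′ → B j (exit b) ≡ B j (exit b′)
  B-exit-shared {b} {b′} {j} same-block j≢b j≢b′ =
    ⟦⟧-injective (ℕ.+-cancelˡ-≡ (B-in-block (blkB P b) j) _ _ (begin
      B-in-block (blkB P b) j + ⟦ B j (exit b) ⟧
        ≡⟨ JI-split b j ⟨
      JI b j
        ≡⟨ trans (JI-offdiag (j≢b ∘ sym)) (sym (JI-offdiag (j≢b′ ∘ sym))) ⟩
      JI b′ j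
        ≡⟨ JI-split b′ j ⟩
      B-in-block (blkB P b′) j + ⟦ B j (exit b′) ⟧
        ≡⟨ cong (λ X → B-in-block X j + ⟦ B j (exit b′) ⟧) same-block ⟨
      B-in-block (blkB P b) j + ⟦ B j (exit b′) ⟧ ∎))
    where open ≡-Reasoning

  -- The entry 2 of Bᵀ A at (exit b, exit b) is not exhausted by the term of row b.
  second-witness : ∀ b → ∃[ j ] j ≢ b × T (A j (exit b)) × T (B j (exit b))
  second-witness b with ∑-other n (λ j → ⟦ A j (exit b) ⟧ * ⟦ B j (exit b) ⟧) b column≢row
    where
    column≢row : ∑ n (λ j → ⟦ A j (exit b) ⟧ * ⟦ B j (exit b) ⟧) ≢ ⟦ A b (exit b) ⟧ * ⟦ B b (exit b) ⟧
    column≢row column≡row = ℕ.1+n≢n {1} (begin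
      2                                                  ≡⟨ JI-diag (exit b) ⟨
      JI (exit b) (exit b)                               ≡⟨ AᵀBᵀ (exit b) (exit b) ⟨
      ∑ n (λ j → ⟦ A j (exit b) ⟧ * ⟦ B j (exit b) ⟧)    ≡⟨ column≡row ⟩
      ⟦ A b (exit b) ⟧ * ⟦ B b (exit b) ⟧                 ≡⟨ ⟦⟧-*-true (proj₁ (exit-leaves b)) (B-exit b) ⟩
      1                                                  ∎)
      where open ≡-Reasoning
  ... | j , j≢b , nonzero = j , j≢b , ⟦⟧-*-nonzero (A j (exit b)) (B j (exit b)) nonzero

  -- A second j with A j (exit b) = B j (exit b) = 1 cannot lie in the block of b (its row of A
  -- would equal that of b), and otherwise row j of B contains both exits, which a black vertex
  -- c ≠ j of their common block also sees, so that (A Bᵀ) c j ≥ 2.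
  exits-separate : ∀ {b b′} → b ≢ b′ → blkB P b ≡ blkB P b′ → blkW P (exit b) ≢ blkW P (exit b′)
  exits-separate {b} {b′} b≢b′ same-block same-target with second-witness b
  ... | j , j≢b , Ajw , Bjw with blkB P j ≟ blkB P b
  ...   | yes same = j≢b (determined-by-block-and-exit same (sym
          (exit-unique j (exit b) Ajw (λ e → proj₂ (exit-leaves b) (trans e same)))))
  ...   | no  other with another-in-block (blkW P (exit b)) j
  ...     | c , c∈Y , c≢j = JIFactor-no-common-pair A B AB c≢j exits-differ
            (Equivalence.from T-≡ (complete c (exit b) c∈Y))
            (Equivalence.from T-≡ (complete c (exit b′) (trans c∈Y same-target)))
            Bjw (subst T (B-exit-shared same-block j≢b j≢b′) Bjw)
    where
    j≢b′ : j ≢ b′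
    j≢b′ j≡b′ = other (trans (cong (blkB P) j≡b′) (sym same-block))
    exits-differ : exit b ≢ exit b′
    exits-differ = b≢b′ ∘ determined-by-block-and-exit same-block

  hits : Fin m → Fin m → Bool
  hits X Y = anyFin n (λ b → ⌊ blkB P b ≟ X ⌋ ∧ ⌊ blkW P (exit b) ≟ Y ⌋)

  compress-row : ∀ X Y → compress A P X Y ≡ ⌊ X ≟ Y ⌋ ∨ hits X Y
  compress-row X Y with X ≟ Y
  ... | yes _   = refl
  ... | no  X≢Y = T-ext edge⇒hit hit⇒edge
    where
    edge : Fin n → Fin n → Bool
    edge b w = A b w ∧ ⌊ blkB P b ≟ X ⌋ ∧ ⌊ blkW P w ≟ Y ⌋
    edge⇒hit : T (anyFin n (λ b → anyFin n (edge b))) → T (hits X Y)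
    edge⇒hit some-edge with anyFin-witness n (λ b → anyFin n (edge b)) some-edge
    ... | b , edgeb with anyFin-witness n (edge b) edgeb
    ...   | w , edgebw with Equivalence.to T-∧ edgebw
    ...     | Abw , b∈X,w∈Y with Equivalence.to T-∧ b∈X,w∈Y
    ...       | b∈X , w∈Y = anyFin-intro n (λ b → ⌊ blkB P b ≟ X ⌋ ∧ ⌊ blkW P (exit b) ≟ Y ⌋) b
                (Equivalence.from T-∧ (b∈X , subst (λ e → T ⌊ blkW P e ≟ Y ⌋) (exit-unique b w Abw w∉X) w∈Y))
      where
      w∉X : blkW P w ≢ blkB P b
      w∉X e = X≢Y (trans (sym (toWitness b∈X)) (trans (sym e) (toWitness w∈Y)))
    hit⇒edge : T (hits X Y) → T (anyFin n (λ b → anyFin n (edge b)))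
    hit⇒edge hit with anyFin-witness n (λ b → ⌊ blkB P b ≟ X ⌋ ∧ ⌊ blkW P (exit b) ≟ Y ⌋) hit
    ... | b , hitb = anyFin-intro n (λ b → anyFin n (edge b)) b (anyFin-intro n (edge b) (exit b)
            (Equivalence.from T-∧ (proj₁ (exit-leaves b) , hitb)))

  black-degree : ∀ X → ∑ m (λ Y → ⟦ compress A P X Y ⟧) ≡ suc s
  black-degree X = begin
    ∑ m (λ Y → ⟦ compress A P X Y ⟧)
      ≡⟨ ∑-cong m (λ Y → trans (cong ⟦_⟧ (compress-row X Y)) (⟦⟧-∨ ⌊ X ≟ Y ⌋ (hits X Y) (disjoint Y))) ⟩
    ∑ m (λ Y → ⟦ ⌊ X ≟ Y ⌋ ⟧ + ⟦ hits X Y ⟧)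
      ≡⟨ ∑-+ m (λ Y → ⟦ ⌊ X ≟ Y ⌋ ⟧) (λ Y → ⟦ hits X Y ⟧) ⟩
    ∑ m (λ Y → ⟦ ⌊ X ≟ Y ⌋ ⟧) + ∑ m (λ Y → ⟦ hits X Y ⟧)
      ≡⟨ cong₂ _+_ (∑-dirac m X) (∑-image n m (λ b → ⌊ blkB P b ≟ X ⌋) (blkW P ∘ exit) separated) ⟩
    1 + blackCount P X
      ≡⟨ cong suc (blacks X) ⟩
    suc s ∎
    where
    open ≡-Reasoning
    disjoint : ∀ Y → ¬ (T ⌊ X ≟ Y ⌋ × T (hits X Y))
    disjoint Y (X≡Y , hit) with anyFin-witness n (λ b → ⌊ blkB P b ≟ X ⌋ ∧ ⌊ blkW P (exit b) ≟ Y ⌋) hit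
    ... | b , hitb with Equivalence.to (T-∧ {⌊ blkB P b ≟ X ⌋}) hitb
    ...   | b∈X , exit∈Y = proj₂ (exit-leaves b)
            (trans (toWitness exit∈Y) (trans (sym (toWitness X≡Y)) (sym (toWitness b∈X))))
    separated : ∀ a b → T ⌊ blkB P a ≟ X ⌋ → T ⌊ blkB P b ≟ X ⌋ →
                blkW P (exit a) ≡ blkW P (exit b) → a ≡ b
    separated a b a∈X b∈X same-target with a ≟ b
    ... | yes a≡b = a≡b
    ... | no  a≢b = contradiction same-target (exits-separate a≢b (trans (toWitness a∈X) (sym (toWitness b∈X))))

JIFactor-transpose : ∀ {n r} (A B : BipMatrix n) → Regular n r A → JIFactor A B → JIFactor (A ᵀ) (B ᵀ)
JIFactor-transpose = transpose-⟦⟧-factor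

swapColours : ∀ {n m} → Partition n m → Partition n m
swapColours P = record { blkB = blkW P ; blkW = blkB P }

T-∧-swap : ∀ x y z → T (x ∧ y ∧ z) → T (x ∧ z ∧ y)
T-∧-swap true true true _ = tt

anyFin²-swap : ∀ n (f g : Fin n → Fin n → Bool) → (∀ i j → T (f i j) → T (g j i)) →
  T (anyFin n (λ i → anyFin n (f i))) → T (anyFin n (λ j → anyFin n (g j)))
anyFin²-swap n f g f⇒g some-f with anyFin-witness n (λ i → anyFin n (f i)) some-f
... | i , fi with anyFin-witness n (f i) fi
...   | j , fij = anyFin-intro n (λ j → anyFin n (g j)) j (anyFin-intro n (g j) i (f⇒g i j fij))

compress-transpose : ∀ {n m} (A : BipMatrix n) (P : Partition n m) X Y →
  compress (A ᵀ) (swapColours P) Y X ≡ compress A P X Y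
compress-transpose {n} A P X Y = cong₂ _∨_
  (T-ext (fromWitness ∘ sym ∘ toWitness) (fromWitness ∘ sym ∘ toWitness))
  (T-ext (anyFin²-swap n edgeᵀ edge (λ w b → T-∧-swap (A b w) ⌊ blkW P w ≟ Y ⌋ ⌊ blkB P b ≟ X ⌋))
         (anyFin²-swap n edge edgeᵀ (λ b w → T-∧-swap (A b w) ⌊ blkB P b ≟ X ⌋ ⌊ blkW P w ≟ Y ⌋)))
  where
  edge edgeᵀ : Fin n → Fin n → Bool
  edge  b w = A b w ∧ ⌊ blkB P b ≟ X ⌋ ∧ ⌊ blkW P w ≟ Y ⌋
  edgeᵀ w b = A b w ∧ ⌊ blkW P w ≟ Y ⌋ ∧ ⌊ blkB P b ≟ X ⌋

proposition4p2 : (n r m : ℕ) (A : BipMatrix n) (P : Partition n m) →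
    3 ≤ r → LehmanK1 n r A → BlocksInduceK n m r A P →
    Regular m r (compress A P)
proposition4p2 n (suc s) m A P (s≤s 2≤s) (regular@(rows , cols) , B , AB) (blacks , whites , complete) =
  black-degrees , white-degrees
  where
  AᵀBᵀ = JIFactor-transpose A B regular AB
  black-degrees = BlackDegree.black-degree A B P 2≤s rows blacks whites complete AB AᵀBᵀ
  white-degrees : ∀ Y → ∑ m (λ X → ⟦ compress A P X Y ⟧) ≡ suc s
  white-degrees Y = trans (∑-cong m (λ X → cong ⟦_⟧ (sym (compress-transpose A P X Y))))
    (BlackDegree.black-degree (A ᵀ) (B ᵀ) (swapColours P) 2≤s cols whites blacks
      (λ w b same → complete b w (sym same)) AᵀBᵀ AB Y)
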